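{- Let $G=(V,E)$ be a finite connected loopless graph with edge lengths $\ell:E\to\mathbb{Z}_{>0}$, and let $H$ be the graph obtained from $G$ by subdividing each edge $e$ exactly $\ell_e-1$ times (notation as in the context). Let $D\in\operatorname{Div}(H)$ be a divisor whose support is contained in $V(G)\subseteq V(H)$. Then: (i) for every $f\colon V(G)\to\mathbb{Z}$, the divisor $D+\operatorname{div}_\ell(f)$ is $G$-admissible and linearly equivalent to $D$ on $H$; (ii) every $G$-admissible divisor $D'$ on $H$ linearly equivalent to $D$ is of the form $D+\operatorname{div}_\ell(f)$ for some $f\colon V(G)\to\mathbb{Z}$.
   Context: $G=(V,E)$ is a finite connected graph without loops (multiple edges allowed). Each edge $\{u,v\}$ gives two oriented edges $uv$ (tail $u$, head $v$) and $vu$; $\mathbb{E}$ is the set of oriented edges and $\bar e$ the reverse of $e$. The length function $\ell$ is extended to $\mathbb{E}$ by $\ell_{\bar e}=\ell_e$. $H$ is obtained by replacing each oriented edge $e=uv$ by a path $u\,x^e_1\,x^e_2\cdots x^e_{\ell_e-1}\,v$ with new vertices, where $x^e_0:=u$, $x^e_{\ell_e}:=v$ and $x^e_i=x^{\bar e}_{\ell_e-i}$. $\operatorname{Div}(H)$ is the free abelian group on $V(H)$; for $F\colon V(H)\to\mathbb{Z}$, $\operatorname{div}(F)(w)=\sum (F(w')-F(w))$, the sum over the edges of $H$ incident to $w$ with $w'$ the other endpoint; divisors differing by some $\operatorname{div}(F)$ are linearly equivalent. A divisor $D$ on $H$ is $G$-admissible if for each oriented edge $e$ of $G$, the values $D(x^e_j)$,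 $j=1,\dots,\ell_e-1$, are all $0$ except for at most one $j$, where the value is $1$. For $f\colon V(G)\to\mathbb{Z}$ and $e=uv\in\mathbb{E}$, set $\delta_e(f)=\lfloor (f(v)-f(u))/\ell_e\rfloor$. The divisor $\operatorname{div}_\ell(f)$ on $H$ is defined by: $\operatorname{div}_\ell(f)(u)=\sum_{e\in\mathbb{E},\ \text{tail}(e)=u}\delta_e(f)$ for $u\in V(G)$; for each oriented edge $e=uv$ with $\ell_e\nmid f(v)-f(u)$, $\operatorname{div}_\ell(f)(x^{\bar e}_{r_e})=1$ where $r_e\in\{1,\dots,\ell_e-1\}$ is the remainder of $f(v)-f(u)$ modulo $\ell_e$; and $0$ at all other vertices of $H$. -}

module Defs where

open import Data.Nat as ℕ using (ℕ; zero; suc; _∸_; NonZero)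
open import Data.Fin as Fin using (Fin; toℕ; fromℕ<)
open import Data.Nat.Properties using (∸-monoˡ-≤)
open import Data.Fin.Properties using () renaming (_≟_ to _≟F_)
open import Data.Integer as ℤ using (ℤ; +_; _+_; _-_; _*_; _/ℕ_; _%ℕ_)
open import Data.Bool using (Bool; true; false; if_then_else_; _∨_; _∧_; not)
open import Data.Product using (Σ; _×_; _,_; ∃)
open import Data.Sum using (_⊎_)
open import Relation.Nullary using (¬_; Dec; yes; no)
open import Relation.Nullary.Decidable using (⌊_⌋)
open import Relation.Binary.PropositionalEquality using (_≡_; _≢_; refl; cong)

∑ : (k : ℕ) → (Fin k → ℤ) → ℤ
∑ zero    f = + 0
∑ (suc k) f = f Fin.zero + ∑ k (λ i → f (Fin.suc i))

anyFin : (k : ℕ) → (Fin k → Bool) → Bool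
anyFin zero    p = false
anyFin (suc k) p = p Fin.zero ∨ anyFin k (λ i → p (Fin.suc i))

pred-< : ∀ {a b} → suc a ℕ.< b → a ℕ.< b ∸ 1
pred-< p = ∸-monoˡ-≤ 1 p

-- A finite multigraph G with vertex set Fin n, (unoriented) edge set
-- Fin m, each edge e having a chosen reference orientation
-- src e → tgt e, and a positive integer length len e.

record MetricGraph : Set where
  field
    n       : ℕ
    m       : ℕ
    src     : Fin m → Fin n
    tgt     : Fin m → Fin n
    len     : Fin m → ℕ
    len-pos : (e : Fin m) → NonZero (len e)

module _ (G : MetricGraph) where
  open MetricGraph G

  Loopless : Set
  Loopless = (e : Fin m) → src e ≢ tgt e

  data Reach : Fin n → Fin n → Set where
    here : ∀ {u} → Reach u u
    fwd  : ∀ {u} (e : Fin m) → Reach (tgt e) u → Reach (src e) u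
    bwd  : ∀ {u} (e : Fin m) → Reach (src e) u → Reach (tgt e) u

  Connected : Set
  Connected = (u v : Fin n) → Reach u v

  -- Vertices: the vertices of G, plus for each edge e the interior
  -- vertices; `mid e i` is the vertex at distance (toℕ i + 1) from src e
  -- along e, i.e. x^{(src e → tgt e)}_{toℕ i + 1}.

  data VH : Set where
    vert : Fin n → VH
    mid  : (e : Fin m) → Fin (len e ∸ 1) → VH

  _≟V_ : (x y : VH) → Dec (x ≡ y)
  vert u  ≟V vert v with u ≟F v
  ... | yes refl = yes refl
  ... | no ne    = no λ { refl → ne refl }
  vert u  ≟V mid e i = no λ ()
  mid e i ≟V vert u  = no λ ()
  mid e i ≟V mid e' i' with e ≟F e'
  ... | no ne = no λ { refl → ne refl }
  ... | yes refl with i ≟F i'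
  ...   | yes refl = yes refl
  ...   | no ne    = no λ { refl → ne refl }

  pos : (e : Fin m) → ℕ → VH
  pos e zero = vert (src e)
  pos e (suc j) with suc j ℕ.<? len e
  ... | yes sj<l = mid e (fromℕ< {j} (pred-< sj<l))
  ... | no _ = vert (tgt e)

  EH : Set
  EH = Σ (Fin m) λ e → Fin (len e)

  endA endB : EH → VH
  endA (e , j) = pos e (toℕ j)
  endB (e , j) = pos e (suc (toℕ j))

  -- Oriented edges of G: (e , true) is src e → tgt e, (e , false) the reverse.
  OE : Set
  OE = Fin m × Bool

  rev : OE → OE
  rev (e , b) = e , not b

  tail head : OE → Fin n
  tail (e , true)  = src e
  tail (e , false) = tgt e
  head (e , true)  = tgt e
  head (e , false) = src e

  ℓ : OE → ℕ
  ℓ (e , _) = len e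

  -- x^ε_i  for an oriented edge ε and 0 ≤ i ≤ ℓ_ε  (so x^ε_i = x^{rev ε}_{ℓ-i})
  x : OE → ℕ → VH
  x (e , true)  i = pos e i
  x (e , false) i = pos e (len e ∸ i)

  -- Divisors on H (H is finite, so Div(H) = functions VH → ℤ)

  Div : Set
  Div = VH → ℤ

  _⊕_ : Div → Div → Div
  (D ⊕ D') w = D w + D' w

  [_≡?_] : VH → VH → ℤ
  [ a ≡? b ] = if ⌊ a ≟V b ⌋ then + 1 else + 0

  ∑EH : (EH → ℤ) → ℤ
  ∑EH g = ∑ m λ e → ∑ (len e) λ j → g (e , j)

  -- div(F)(w) = Σ_{edges h of H incident to w} (F(w') - F(w)),
  -- w' the other endpoint of h (H has no loops since G is loopless).
  divH : (VH → ℤ) → Div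
  divH F w = ∑EH λ h →
      [ endA h ≡? w ] * (F (endB h) - F (endA h))
    + [ endB h ≡? w ] * (F (endA h) - F (endB h))

  LinEquiv : Div → Div → Set
  LinEquiv D D' = Σ (VH → ℤ) λ F → (w : VH) → D' w ≡ D w + divH F w

  SupportInV : Div → Set
  SupportInV D = (e : Fin m) (i : Fin (len e ∸ 1)) → D (mid e i) ≡ + 0

  Admissible : Div → Set
  Admissible D = (ε : OE) →
      ((j : ℕ) → 1 ℕ.≤ j → j ℕ.< ℓ ε → (D (x ε j) ≡ + 0) ⊎ (D (x ε j) ≡ + 1))
    × ((j k : ℕ) → 1 ℕ.≤ j → j ℕ.< ℓ ε → 1 ℕ.≤ k → k ℕ.< ℓ ε →
         D (x ε j) ≡ + 1 → D (x ε k) ≡ + 1 → j ≡ k)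

  Δ : (Fin n → ℤ) → OE → ℤ
  Δ f ε = f (head ε) - f (tail ε)

  -- δ_ε(f) = ⌊ (f(v) - f(u)) / ℓ_ε ⌋   (_/ℕ_ is floor division for positive divisor)
  δ : (Fin n → ℤ) → OE → ℤ
  δ f (e , b) = _/ℕ_ (Δ f (e , b)) (len e) {{len-pos e}}

  r : (Fin n → ℤ) → OE → ℕ
  r f (e , b) = _%ℕ_ (Δ f (e , b)) (len e) {{len-pos e}}

  ∑OE : (OE → ℤ) → ℤ
  ∑OE g = ∑ m λ e → g (e , true) + g (e , false)

  anyOE : (OE → Bool) → Bool
  anyOE p = anyFin m λ e → p (e , true) ∨ p (e , false)

  nonzero? : ℕ → Bool
  nonzero? zero    = false
  nonzero? (suc _) = true

  div-ℓ : (Fin n → ℤ) → Div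
  div-ℓ f (vert u) = ∑OE λ ε → if ⌊ tail ε ≟F u ⌋ then δ f ε else + 0
  div-ℓ f w@(mid _ _) =
    if anyOE (λ ε → nonzero? (r f ε) ∧ ⌊ x (rev ε) (r f ε) ≟V w ⌋)
    then + 1 else + 0

-- Extend f : V(G) → ℤ to H piecewise linearly along each edge e of length L: writing
-- f(tgt e) − f(src e) = qL + r with 0 ≤ r < L, the extension has slope q on the first L − r
-- steps and q + 1 on the remaining r. Its slopes leaving the two ends of e are δ_e(f) and
-- δ_ē(f), and its second difference on the interior of e vanishes except for a 1 at the kink
-- x^ē_r (present only when r ≠ 0); hence its divisor is div_ℓ(f), which gives (i) because D
-- vanishes off V(G). Conversely, if D′ = D + div(F) is G-admissible, then along each edge the
-- second differences of F are 0 except for at most one 1, so F is again piecewise linear with a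
-- single unit kink; uniqueness of Euclidean division identifies it with the extension of F|V(G),
-- so div(F) = div_ℓ(F|V(G)).

module Submission where

open import Level using (Level)
open import Defs
open import Data.Nat as ℕ using (ℕ; zero; suc; _∸_; NonZero; z≤n; s≤s)
import Data.Nat.Properties as ℕP
open import Data.Fin as Fin using (Fin; toℕ; fromℕ<)
import Data.Fin.Properties as FinP
open import Data.Fin.Properties using () renaming (_≟_ to _≟F_)
open import Data.Integer as ℤ using (ℤ; +_; _+_; _-_; _*_; -_; _/ℕ_; _%ℕ_)
import Data.Integer.Properties as ℤP
open import Data.Integer.DivMod using (a≡a%ℕn+[a/ℕn]*n; n%ℕd<d)
open import Data.Integer.Tactic.RingSolver using (solve-∀)
open import Algebra.Properties.CommutativeSemigroup ℤP.+-commutativeSemigroup using (interchange)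
open import Algebra.Properties.AbelianGroup ℤP.+-0-abelianGroup using () renaming (∙-cancelʳ to +-cancelʳ)
open import Data.Bool using (Bool; true; false; if_then_else_; _∨_; _∧_)
import Data.Bool.Properties as BoolP
open import Data.Product using (Σ; ∃-syntax; _×_; _,_; proj₁; proj₂)
open import Data.Sum using (_⊎_; inj₁; inj₂)
open import Function using (_∘_)
open import Function.Bundles using (_⇔_; mk⇔; Equivalence)
open import Relation.Nullary using (¬_; Dec; yes; no; contradiction)
open import Relation.Nullary.Decidable using (⌊_⌋; _×-dec_)
open import Relation.Binary.Definitions using (tri<; tri≈; tri>)
open import Relation.Binary.PropositionalEquality

∑-cong : ∀ k {f g : Fin k → ℤ} → (∀ i → f i ≡ g i) → ∑ k f ≡ ∑ k g
∑-cong zero    f≗g = refl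
∑-cong (suc k) f≗g = cong₂ _+_ (f≗g Fin.zero) (∑-cong k (f≗g ∘ Fin.suc))

∑-distrib-+ : ∀ k (f g : Fin k → ℤ) → ∑ k (λ i → f i + g i) ≡ ∑ k f + ∑ k g
∑-distrib-+ zero    f g = refl
∑-distrib-+ (suc k) f g =
  trans (cong (λ z → (f Fin.zero + g Fin.zero) + z) (∑-distrib-+ k (f ∘ Fin.suc) (g ∘ Fin.suc)))
        (interchange (f Fin.zero) (g Fin.zero) _ _)

∑-zero : ∀ k (f : Fin k → ℤ) → (∀ i → f i ≡ + 0) → ∑ k f ≡ + 0
∑-zero zero    f f≡0 = refl
∑-zero (suc k) f f≡0 = cong₂ _+_ (f≡0 Fin.zero) (∑-zero k (f ∘ Fin.suc) (f≡0 ∘ Fin.suc))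

∑-single : ∀ k (f : Fin k → ℤ) i₀ → (∀ i → i ≢ i₀ → f i ≡ + 0) → ∑ k f ≡ f i₀
∑-single (suc k) f Fin.zero others =
  trans (cong (λ z → f Fin.zero + z) (∑-zero k (f ∘ Fin.suc) (λ i → others (Fin.suc i) λ ())))
        (ℤP.+-identityʳ _)
∑-single (suc k) f (Fin.suc i₀) others =
  trans (cong (_+ ∑ k (f ∘ Fin.suc)) (others Fin.zero λ ()))
        (trans (ℤP.+-identityˡ _)
               (∑-single k (f ∘ Fin.suc) i₀ λ i i≢i₀ → others (Fin.suc i) (i≢i₀ ∘ FinP.suc-injective)))

∑-toℕ-single : ∀ k (T : ℕ → ℤ) {J} → J ℕ.< k → (∀ j → j ℕ.< k → j ≢ J → T j ≡ + 0) →
               ∑ k (T ∘ toℕ) ≡ T J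
∑-toℕ-single k T J<k others =
  trans (∑-single k (T ∘ toℕ) (fromℕ< J<k) λ i i≢ →
           others (toℕ i) (FinP.toℕ<n i)
             (λ i≡J → i≢ (FinP.toℕ-injective (trans i≡J (sym (FinP.toℕ-fromℕ< J<k))))))
        (cong T (FinP.toℕ-fromℕ< J<k))

anyFin-false : ∀ k (p : Fin k → Bool) → (∀ i → p i ≡ false) → anyFin k p ≡ false
anyFin-false zero    p p≡false = refl
anyFin-false (suc k) p p≡false =
  cong₂ _∨_ (p≡false Fin.zero) (anyFin-false k (p ∘ Fin.suc) (p≡false ∘ Fin.suc))

anyFin-single : ∀ k (p : Fin k → Bool) i₀ → (∀ i → i ≢ i₀ → p i ≡ false) → anyFin k p ≡ p i₀
anyFin-single (suc k) p Fin.zero others =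
  trans (cong (p Fin.zero ∨_) (anyFin-false k (p ∘ Fin.suc) (λ i → others (Fin.suc i) λ ())))
        (BoolP.∨-identityʳ _)
anyFin-single (suc k) p (Fin.suc i₀) others =
  trans (cong (_∨ anyFin k (p ∘ Fin.suc)) (others Fin.zero λ ()))
        (anyFin-single k (p ∘ Fin.suc) i₀ λ i i≢i₀ → others (Fin.suc i) (i≢i₀ ∘ FinP.suc-injective))

private variable
  a b : Level
  A : Set a
  B : Set b

𝟙 : Dec A → ℤ
𝟙 d = if ⌊ d ⌋ then + 1 else + 0

⌊⌋-yes : (d : Dec A) → A → ⌊ d ⌋ ≡ true
⌊⌋-yes (yes _) _  = refl
⌊⌋-yes (no ¬x) x = contradiction x ¬x

⌊⌋-no : (d : Dec A) → ¬ A → ⌊ d ⌋ ≡ false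
⌊⌋-no (yes x) ¬x = contradiction x ¬x
⌊⌋-no (no _)  _  = refl

⌊⌋-⇔ : A ⇔ B → (d : Dec A) (d′ : Dec B) → ⌊ d ⌋ ≡ ⌊ d′ ⌋
⌊⌋-⇔ A⇔B (yes x) d′ = sym (⌊⌋-yes d′ (Equivalence.to A⇔B x))
⌊⌋-⇔ A⇔B (no ¬x) d′ = sym (⌊⌋-no d′ (¬x ∘ Equivalence.from A⇔B))

𝟙-yes : (d : Dec A) → A → 𝟙 d ≡ + 1
𝟙-yes d x = cong (λ b → if b then + 1 else + 0) (⌊⌋-yes d x)

𝟙-no : (d : Dec A) → ¬ A → 𝟙 d ≡ + 0
𝟙-no d ¬x = cong (λ b → if b then + 1 else + 0) (⌊⌋-no d ¬x)

𝟙≡1⇒ : (d : Dec A) → 𝟙 d ≡ + 1 → A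
𝟙≡1⇒ (yes x) _ = x

𝟙∈01 : (d : Dec A) → (𝟙 d ≡ + 0) ⊎ (𝟙 d ≡ + 1)
𝟙∈01 (yes _) = inj₂ refl
𝟙∈01 (no _)  = inj₁ refl

𝟙-yes-* : (d : Dec A) → A → ∀ z → 𝟙 d * z ≡ z
𝟙-yes-* d x z = trans (cong (_* z) (𝟙-yes d x)) (ℤP.*-identityˡ z)

𝟙-no-* : (d : Dec A) → ¬ A → ∀ z → 𝟙 d * z ≡ + 0
𝟙-no-* d ¬x z = trans (cong (_* z) (𝟙-no d ¬x)) (ℤP.*-zeroˡ z)

𝟙-* : (d : Dec A) (z : ℤ) → 𝟙 d * z ≡ (if ⌊ d ⌋ then z else + 0)
𝟙-* (yes _) z = ℤP.*-identityˡ z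
𝟙-* (no _)  z = ℤP.*-zeroˡ z

𝟙-⇔ : A ⇔ B → (d : Dec A) (d′ : Dec B) → 𝟙 d ≡ 𝟙 d′
𝟙-⇔ A⇔B d d′ = cong (λ b → if b then + 1 else + 0) (⌊⌋-⇔ A⇔B d d′)

euclid-< : ∀ {L R R′} {Q Q′ : ℤ} → R ℕ.< L → Q ℤ.< Q′ → + R + Q * + L ℤ.< + R′ + Q′ * + L
euclid-< {L} {R} {R′} {Q} {Q′} R<L Q<Q′ = begin-strict
  + R + Q * + L    <⟨ ℤP.+-monoˡ-< (Q * + L) (ℤ.+<+ R<L) ⟩
  + L + Q * + L    ≡⟨ sym (ℤP.suc-* Q (+ L)) ⟩
  ℤ.suc Q * + L    ≤⟨ ℤP.*-monoʳ-≤-nonNeg (+ L) (ℤP.i<j⇒suc[i]≤j Q<Q′) ⟩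
  Q′ * + L         ≤⟨ ℤP.i≤j+i (Q′ * + L) (+ R′) ⟩
  + R′ + Q′ * + L  ∎
  where open ℤP.≤-Reasoning

euclid-unique : ∀ {L R R′} {Q Q′ : ℤ} → R ℕ.< L → R′ ℕ.< L →
                + R + Q * + L ≡ + R′ + Q′ * + L → Q ≡ Q′ × R ≡ R′
euclid-unique {L} {Q = Q} {Q′} R<L R′<L eq with ℤP.<-cmp Q Q′
... | tri< Q<Q′ _ _ = contradiction eq (ℤP.<⇒≢ (euclid-< R<L Q<Q′))
... | tri> _ _ Q>Q′ = contradiction (sym eq) (ℤP.<⇒≢ (euclid-< R′<L Q>Q′))
... | tri≈ _ refl _ = refl , ℤP.+-injective (+-cancelʳ (Q * + L) _ _ eq)

/ℕ-%ℕ-unique : ∀ (n : ℤ) L .{{_ : NonZero L}} {Q R} → R ℕ.< L → n ≡ + R + Q * + L →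
               n /ℕ L ≡ Q × n %ℕ L ≡ R
/ℕ-%ℕ-unique n L R<L n≡ = euclid-unique (n%ℕd<d n L) R<L (trans (sym (a≡a%ℕn+[a/ℕn]*n n L)) n≡)

i-j≡-[j-i] : ∀ i j → i - j ≡ - (j - i)
i-j≡-[j-i] = solve-∀

secondDiff : (ℕ → ℤ) → ℕ → ℤ
secondDiff a k = (a (suc (suc k)) - a (suc k)) + (a k - a (suc k))

secondDiff-cong : ∀ {L} {a b : ℕ → ℤ} → (∀ j → j ℕ.≤ L → a j ≡ b j) →
                  ∀ k → suc k ℕ.< L → secondDiff a k ≡ secondDiff b k
secondDiff-cong a≗b k k+2≤L =
  cong₂ (λ x y → x + y)
    (cong₂ _-_ (a≗b _ k+2≤L) (a≗b _ (ℕP.<⇒≤ k+2≤L)))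
    (cong₂ _-_ (a≗b _ (ℕP.<⇒≤ (ℕP.<⇒≤ k+2≤L))) (a≗b _ (ℕP.<⇒≤ k+2≤L)))

secondDiff-unique : ∀ L (a b : ℕ → ℤ) → a 0 ≡ b 0 → a 1 ≡ b 1 →
                    (∀ k → suc k ℕ.< L → secondDiff a k ≡ secondDiff b k) →
                    ∀ j → j ℕ.≤ L → a j ≡ b j
secondDiff-unique L a b a₀≡b₀ a₁≡b₁ same = λ
  { zero    _     → a₀≡b₀
  ; (suc j) j+1≤L → proj₂ (consecutive j j+1≤L) }
  where
  recover : ∀ (c : ℕ → ℤ) k → c (suc (suc k)) ≡ secondDiff c k + (c (suc k) + c (suc k) - c k)
  recover c k = identity (c k) (c (suc k)) (c (suc (suc k)))
    where
    identity : ∀ x₀ x₁ x₂ → x₂ ≡ ((x₂ - x₁) + (x₀ - x₁)) + (x₁ + x₁ - x₀)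
    identity = solve-∀

  consecutive : ∀ j → suc j ℕ.≤ L → a j ≡ b j × a (suc j) ≡ b (suc j)
  consecutive zero    _     = a₀≡b₀ , a₁≡b₁
  consecutive (suc j) j+2≤L with consecutive j (ℕP.<⇒≤ j+2≤L)
  ... | aⱼ≡bⱼ , aⱼ₊₁≡bⱼ₊₁ = aⱼ₊₁≡bⱼ₊₁ , (begin
    a (suc (suc j))                                    ≡⟨ recover a j ⟩
    secondDiff a j + (a (suc j) + a (suc j) - a j)     ≡⟨ cong₂ (λ x y → x + y) (same j j+2≤L)
                                                            (cong₂ (λ x y → y + y - x) aⱼ≡bⱼ aⱼ₊₁≡bⱼ₊₁) ⟩
    secondDiff b j + (b (suc j) + b (suc j) - b j)     ≡⟨ sym (recover b j) ⟩
    b (suc (suc j))                                    ∎)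
    where open ≡-Reasoning

ramp-step : ∀ j P → + (suc j ∸ P) - + (j ∸ P) ≡ 𝟙 (P ℕ.≤? j)
ramp-step j       zero    = identity (+ j)
  where
  identity : ∀ x → (+ 1 + x) - x ≡ + 1
  identity = solve-∀
ramp-step zero    (suc P) = cong (λ n → + n - + 0) (ℕP.0∸n≡0 P)
ramp-step (suc j) (suc P) = trans (ramp-step j P) (𝟙-⇔ (mk⇔ s≤s ℕ.s≤s⁻¹) (P ℕ.≤? j) (suc P ℕ.≤? suc j))

secondDiff-ramp : ∀ P k → secondDiff (λ j → + (j ∸ P)) k ≡ 𝟙 (suc k ℕ.≟ P)
secondDiff-ramp zero                k       = identity (+ k)
  where
  identity : ∀ x → ((+ 1 + (+ 1 + x)) - (+ 1 + x)) + (x - (+ 1 + x)) ≡ + 0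
  identity = solve-∀
secondDiff-ramp (suc zero)          zero    = refl
secondDiff-ramp (suc (suc P))       zero    = cong (λ n → (+ n - + 0) + (+ 0 - + 0)) (ℕP.0∸n≡0 P)
secondDiff-ramp (suc P)             (suc k) =
  trans (secondDiff-ramp P k) (𝟙-⇔ (mk⇔ (cong suc) ℕP.suc-injective) (suc k ℕ.≟ P) (suc (suc k) ℕ.≟ suc P))

kink : ℤ → ℤ → ℕ → ℕ → ℤ
kink a s P j = a + + j * s + + (j ∸ P)

kink-0 : ∀ a s P → kink a s P 0 ≡ a
kink-0 a s P = trans (cong (λ n → a + + 0 * s + + n) (ℕP.0∸n≡0 P)) (identity a s)
  where
  identity : ∀ a s → a + + 0 * s + + 0 ≡ a
  identity = solve-∀

kink-1 : ∀ a s {P} → 1 ℕ.≤ P → kink a s P 1 ≡ a + s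
kink-1 a s (s≤s {n = P} _) = trans (cong (λ n → a + + 1 * s + + n) (ℕP.0∸n≡0 P)) (identity a s)
  where
  identity : ∀ a s → a + + 1 * s + + 0 ≡ a + s
  identity = solve-∀

kink-step : ∀ a s P j → kink a s P (suc j) - kink a s P j ≡ s + 𝟙 (P ℕ.≤? j)
kink-step a s P j =
  trans (identity a s (+ j) (+ (j ∸ P)) (+ (suc j ∸ P))) (cong (λ z → s + z) (ramp-step j P))
  where
  identity : ∀ a s x R₀ R₁ → (a + (+ 1 + x) * s + R₁) - (a + x * s + R₀) ≡ s + (R₁ - R₀)
  identity = solve-∀

secondDiff-kink : ∀ a s P k → secondDiff (kink a s P) k ≡ 𝟙 (suc k ℕ.≟ P)
secondDiff-kink a s P k =
  trans (identity a s (+ k) (+ (k ∸ P)) (+ (suc k ∸ P)) (+ (suc (suc k) ∸ P))) (secondDiff-ramp P k)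
  where
  identity : ∀ a s x R₀ R₁ R₂ →
    ((a + (+ 1 + (+ 1 + x)) * s + R₂) - (a + (+ 1 + x) * s + R₁)) + ((a + x * s + R₀) - (a + (+ 1 + x) * s + R₁))
      ≡ (R₂ - R₁) + (R₀ - R₁)
  identity = solve-∀

kink-excess : ∀ a s P L → kink a s P L - a ≡ + (L ∸ P) + s * + L
kink-excess a s P L = identity a (+ L) s (+ (L ∸ P))
  where
  identity : ∀ a L s R → (a + L * s + R) - a ≡ R + s * L
  identity = solve-∀

-- The value at L is a + s L + (L - P) with 0 ≤ L - P < L, so Euclidean division recovers s and P.
kink-unique : ∀ {L P P′} a s s′ → 1 ℕ.≤ P → P ℕ.≤ L → 1 ℕ.≤ P′ → P′ ℕ.≤ L →
              kink a s P L ≡ kink a s′ P′ L → s ≡ s′ × P ≡ P′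
kink-unique {L} {P} {P′} a s s′ 1≤P P≤L 1≤P′ P′≤L same-end
  with euclid-unique (ℕP.∸-monoʳ-< 1≤P P≤L) (ℕP.∸-monoʳ-< 1≤P′ P′≤L)
         (trans (sym (kink-excess a s P L)) (trans (cong (_- a) same-end) (kink-excess a s′ P′ L)))
... | s≡s′ , L∸P≡L∸P′ = s≡s′ , ℕP.∸-cancelˡ-≡ P≤L P′≤L L∸P≡L∸P′

-- `Admissible G D` unfolds to `∀ ε → AtMostOneChip (ℓ G ε) (λ j → D (x G ε j))`.
AtMostOneChip : ℕ → (ℕ → ℤ) → Set
AtMostOneChip L c =
    ((j : ℕ) → 1 ℕ.≤ j → j ℕ.< L → (c j ≡ + 0) ⊎ (c j ≡ + 1))
  × ((j k : ℕ) → 1 ℕ.≤ j → j ℕ.< L → 1 ℕ.≤ k → k ℕ.< L → c j ≡ + 1 → c k ≡ + 1 → j ≡ k)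

ChipAt : ℕ → (ℕ → ℤ) → ℕ → Set
ChipAt L c P = ∀ j → 1 ℕ.≤ j → j ℕ.< L → c j ≡ 𝟙 (j ℕ.≟ P)

chipAt⇒atMostOneChip : ∀ {L c} P → ChipAt L c P → AtMostOneChip L c
chipAt⇒atMostOneChip {L} {c} P chip =
    (λ j 1≤j j<L → subst (λ z → (z ≡ + 0) ⊎ (z ≡ + 1)) (sym (chip j 1≤j j<L)) (𝟙∈01 (j ℕ.≟ P)))
  , λ j k 1≤j j<L 1≤k k<L cⱼ≡1 cₖ≡1 →
      trans (at-chip j 1≤j j<L cⱼ≡1) (sym (at-chip k 1≤k k<L cₖ≡1))
  where
  at-chip : ∀ j → 1 ℕ.≤ j → j ℕ.< L → c j ≡ + 1 → j ≡ P
  at-chip j 1≤j j<L cⱼ≡1 = 𝟙≡1⇒ (j ℕ.≟ P) (trans (sym (chip j 1≤j j<L)) cⱼ≡1)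

atMostOneChip-reverse : ∀ {L c} → AtMostOneChip L c → AtMostOneChip L (λ j → c (L ∸ j))
atMostOneChip-reverse {L} (zero-one , unique) =
    (λ j 1≤j j<L → zero-one (L ∸ j) (ℕP.m<n⇒0<n∸m j<L) (reflect<L 1≤j j<L))
  , λ j k 1≤j j<L 1≤k k<L cⱼ≡1 cₖ≡1 →
      ℕP.∸-cancelˡ-≡ (ℕP.<⇒≤ j<L) (ℕP.<⇒≤ k<L)
        (unique (L ∸ j) (L ∸ k) (ℕP.m<n⇒0<n∸m j<L) (reflect<L 1≤j j<L)
                (ℕP.m<n⇒0<n∸m k<L) (reflect<L 1≤k k<L) cⱼ≡1 cₖ≡1)
  where
  reflect<L : ∀ {j} → 1 ℕ.≤ j → j ℕ.< L → L ∸ j ℕ.< L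
  reflect<L 1≤j j<L = ℕP.∸-monoʳ-< 1≤j (ℕP.<⇒≤ j<L)

chipAt-intro : ∀ {L c} → (∀ j → 1 ℕ.≤ j → j ℕ.< L → (c j ≡ + 0) ⊎ (c j ≡ + 1)) → ∀ P →
               (∀ j → 1 ℕ.≤ j → j ℕ.< L → j ≡ P → c j ≡ + 1) →
               (∀ j → 1 ℕ.≤ j → j ℕ.< L → c j ≡ + 1 → j ≡ P) → ChipAt L c P
chipAt-intro zero-one P chip-at-P only-P j 1≤j j<L with j ℕ.≟ P
... | yes j≡P = chip-at-P j 1≤j j<L j≡P
... | no  j≢P with zero-one j 1≤j j<L
...   | inj₁ cⱼ≡0 = cⱼ≡0
...   | inj₂ cⱼ≡1 = contradiction (only-P j 1≤j j<L cⱼ≡1) j≢P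

-- If there is no chip, P = L: a chip at the endpoint is invisible to ChipAt.
atMostOneChip⇒chipAt : ∀ {L c} → 1 ℕ.≤ L → AtMostOneChip L c →
                       ∃[ P ] 1 ℕ.≤ P × P ℕ.≤ L × ChipAt L c P
atMostOneChip⇒chipAt {L} {c} 1≤L (zero-one , unique)
  with FinP.any? {n = L} (λ i → (1 ℕ.≤? toℕ i) ×-dec (c (toℕ i) ℤ.≟ + 1))
... | yes (i , 1≤i , cᵢ≡1) =
  toℕ i , 1≤i , ℕP.<⇒≤ (FinP.toℕ<n i) ,
  chipAt-intro zero-one (toℕ i) (λ { _ _ _ refl → cᵢ≡1 })
    (λ j 1≤j j<L cⱼ≡1 → unique j (toℕ i) 1≤j j<L 1≤i (FinP.toℕ<n i) cⱼ≡1 cᵢ≡1)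
... | no no-chip =
  L , 1≤L , ℕP.≤-refl ,
  chipAt-intro zero-one L (λ { _ _ j<L refl → contradiction j<L (ℕP.<-irrefl refl) })
    (λ j 1≤j j<L cⱼ≡1 → contradiction (fromℕ< j<L , subst (λ t → 1 ℕ.≤ t × c t ≡ + 1)
                                          (sym (FinP.toℕ-fromℕ< j<L)) (1≤j , cⱼ≡1)) no-chip)

<∸1⇒suc< : ∀ {a L} → a ℕ.< L ∸ 1 → suc a ℕ.< L
<∸1⇒suc< {L = suc L} a<L = s≤s a<L

module Subdivision (G : MetricGraph) where
  open MetricGraph G

  len≥1 : ∀ e → 1 ℕ.≤ len e
  len≥1 e = ℕ.>-nonZero⁻¹ (len e) {{len-pos e}}

  suc[len∸1]≡len : ∀ e → suc (len e ∸ 1) ≡ len e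
  suc[len∸1]≡len e = ℕP.suc-pred (len e) {{len-pos e}}

  vert-injective : ∀ {u v} → vert {G} u ≡ vert v → u ≡ v
  vert-injective refl = refl

  vert≢mid : ∀ {u e i} → vert {G} u ≢ mid e i
  vert≢mid ()

  pos-interior : ∀ e k (k+1<len : suc k ℕ.< len e) → pos G e (suc k) ≡ mid e (fromℕ< (pred-< k+1<len))
  pos-interior e k k+1<len with suc k ℕ.<? len e
  ... | yes _ = refl
  ... | no ¬k+1<len = contradiction k+1<len ¬k+1<len

  pos-mid : ∀ e i → pos G e (suc (toℕ i)) ≡ mid e i
  pos-mid e i = trans (pos-interior e (toℕ i) (<∸1⇒suc< (FinP.toℕ<n i))) (cong (mid e) (FinP.fromℕ<-toℕ i _))

  pos-beyond : ∀ e j → len e ℕ.≤ suc j → pos G e (suc j) ≡ vert (tgt e)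
  pos-beyond e j len≤j+1 with suc j ℕ.<? len e
  ... | yes j+1<len = contradiction len≤j+1 (ℕP.<⇒≱ j+1<len)
  ... | no _ = refl

  pos-len : ∀ e → pos G e (len e) ≡ vert (tgt e)
  pos-len e = subst (λ j → pos G e j ≡ vert (tgt e)) (suc[len∸1]≡len e)
                (pos-beyond e (len e ∸ 1) (ℕP.≤-reflexive (sym (suc[len∸1]≡len e))))

  pos-interior≢vert : ∀ e k u → suc k ℕ.< len e → pos G e (suc k) ≢ vert u
  pos-interior≢vert e k u k+1<len eq = vert≢mid (trans (sym eq) (pos-interior e k k+1<len))

  pos≡mid⇒edge : ∀ e j {e′} (i : Fin (len e′ ∸ 1)) → pos G e j ≡ mid e′ i → e ≡ e′
  pos≡mid⇒edge e zero    i ()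
  pos≡mid⇒edge e (suc j) i eq with suc j ℕ.<? len e
  pos≡mid⇒edge e (suc j) i refl | yes _ = refl
  pos≡mid⇒edge e (suc j) i ()   | no _

  pos≡mid⇔ : ∀ e j (i : Fin (len e ∸ 1)) → pos G e j ≡ mid e i ⇔ suc (toℕ i) ≡ j
  pos≡mid⇔ e j i = mk⇔ (index j) (λ { refl → pos-mid e i })
    where
    index : ∀ j → pos G e j ≡ mid e i → suc (toℕ i) ≡ j
    index zero    ()
    index (suc j) eq with suc j ℕ.<? len e
    index (suc j) refl | yes _ = cong suc (FinP.toℕ-fromℕ< _)
    index (suc j) ()   | no _

  forwardTerm backwardTerm : (VH G → ℤ) → VH G → Fin m → ℕ → ℤ
  forwardTerm  F w e j = 𝟙 (_≟V_ G (pos G e j) w) * (F (pos G e (suc j)) - F (pos G e j))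
  backwardTerm F w e j = 𝟙 (_≟V_ G (pos G e (suc j)) w) * (F (pos G e j) - F (pos G e (suc j)))

  divH-by-edges : ∀ F w → divH G F w ≡
    ∑ m λ e → ∑ (len e) (forwardTerm F w e ∘ toℕ) + ∑ (len e) (backwardTerm F w e ∘ toℕ)
  divH-by-edges F w = ∑-cong m λ e → ∑-distrib-+ (len e) _ _

  divH-cong : ∀ {F F′} → (∀ v → F v ≡ F′ v) → ∀ w → divH G F w ≡ divH G F′ w
  divH-cong F≗F′ w = ∑-cong m λ e → ∑-cong (len e) λ j →
    cong₂ (λ a b → 𝟙 (_≟V_ G (endA G (e , j)) w) * (b - a) + 𝟙 (_≟V_ G (endB G (e , j)) w) * (a - b))
      (F≗F′ (endA G (e , j))) (F≗F′ (endB G (e , j)))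

  divH-vert : ∀ F u → divH G F (vert u) ≡ ∑ m λ e →
      (if ⌊ src e ≟F u ⌋ then F (pos G e 1) - F (vert (src e)) else + 0)
    + (if ⌊ tgt e ≟F u ⌋ then F (pos G e (len e ∸ 1)) - F (vert (tgt e)) else + 0)
  divH-vert F u = trans (divH-by-edges F (vert u)) (∑-cong m λ e → cong₂ _+_ (from-src e) (into-tgt e))
    where
    at-vert : ∀ s z → 𝟙 (_≟V_ G (vert s) (vert u)) * z ≡ (if ⌊ s ≟F u ⌋ then z else + 0)
    at-vert s z = trans (𝟙-* (_≟V_ G (vert s) (vert u)) z)
                        (cong (λ b → if b then z else + 0) (⌊⌋-⇔ (mk⇔ vert-injective (cong vert)) _ _))

    from-src : ∀ e → ∑ (len e) (forwardTerm F (vert u) e ∘ toℕ)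
                   ≡ (if ⌊ src e ≟F u ⌋ then F (pos G e 1) - F (vert (src e)) else + 0)
    from-src e = trans
      (∑-toℕ-single (len e) (forwardTerm F (vert u) e) (len≥1 e) λ
        { zero    _       0≢0 → contradiction refl 0≢0
        ; (suc k) k+1<len _   → 𝟙-no-* (_≟V_ G _ (vert u)) (pos-interior≢vert e k u k+1<len) _ })
      (at-vert (src e) _)

    into-tgt : ∀ e → ∑ (len e) (backwardTerm F (vert u) e ∘ toℕ)
                   ≡ (if ⌊ tgt e ≟F u ⌋ then F (pos G e (len e ∸ 1)) - F (vert (tgt e)) else + 0)
    into-tgt e = trans
      (∑-toℕ-single (len e) (backwardTerm F (vert u) e) (ℕP.≤-reflexive (suc[len∸1]≡len e)) λ j j<len j≢ →
        𝟙-no-* (_≟V_ G _ (vert u))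
          (pos-interior≢vert e j u (ℕP.≤∧≢⇒< j<len (j≢ ∘ cong (_∸ 1)))) _)
      (trans (cong (λ t → 𝟙 (_≟V_ G t (vert u)) * (F (pos G e (len e ∸ 1)) - F t))
                   (pos-beyond e (len e ∸ 1) (ℕP.≤-reflexive (sym (suc[len∸1]≡len e)))))
             (at-vert (tgt e) _))

  divH-mid : ∀ F e i → divH G F (mid e i) ≡ secondDiff (F ∘ pos G e) (toℕ i)
  divH-mid F e i = begin
    divH G F (mid e i)
      ≡⟨ trans (divH-by-edges F (mid e i)) (∑-single m _ e elsewhere) ⟩
    ∑ (len e) (forwardTerm F (mid e i) e ∘ toℕ) + ∑ (len e) (backwardTerm F (mid e i) e ∘ toℕ)
      ≡⟨ cong₂ _+_ (∑-toℕ-single (len e) (forwardTerm F (mid e i) e) i+1<len λ j _ j≢ →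
                      𝟙-no-* (_≟V_ G (pos G e j) (mid e i)) (j≢ ∘ sym ∘ index) _)
                   (∑-toℕ-single (len e) (backwardTerm F (mid e i) e) (ℕP.<-trans (ℕP.n<1+n _) i+1<len) λ j _ j≢ →
                      𝟙-no-* (_≟V_ G (pos G e (suc j)) (mid e i)) (j≢ ∘ sym ∘ ℕP.suc-injective ∘ index) _) ⟩
    forwardTerm F (mid e i) e (suc (toℕ i)) + backwardTerm F (mid e i) e (toℕ i)
      ≡⟨ cong₂ _+_ (𝟙-yes-* (_≟V_ G _ (mid e i)) (pos-mid e i) _)
                   (𝟙-yes-* (_≟V_ G _ (mid e i)) (pos-mid e i) _) ⟩
    secondDiff (F ∘ pos G e) (toℕ i)
      ∎
    where
    open ≡-Reasoning
    i+1<len : suc (toℕ i) ℕ.< len e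
    i+1<len = <∸1⇒suc< (FinP.toℕ<n i)
    index : ∀ {j} → pos G e j ≡ mid e i → suc (toℕ i) ≡ j
    index = Equivalence.to (pos≡mid⇔ e _ i)
    elsewhere : ∀ e′ → e′ ≢ e →
      ∑ (len e′) (forwardTerm F (mid e i) e′ ∘ toℕ) + ∑ (len e′) (backwardTerm F (mid e i) e′ ∘ toℕ) ≡ + 0
    elsewhere e′ e′≢e = cong₂ _+_
      (∑-zero (len e′) _ λ j → 𝟙-no-* (_≟V_ G (pos G e′ (toℕ j)) (mid e i)) (off-edge (toℕ j)) _)
      (∑-zero (len e′) _ λ j → 𝟙-no-* (_≟V_ G (pos G e′ (suc (toℕ j))) (mid e i)) (off-edge (suc (toℕ j))) _)
      where
      off-edge : ∀ j → pos G e′ j ≢ mid e i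
      off-edge j = e′≢e ∘ pos≡mid⇒edge e′ j i

  nonzero?-≡0-∧ : ∀ {k} {c} → k ≡ 0 → nonzero? G k ∧ c ≡ false
  nonzero?-≡0-∧ refl = refl

  nonzero?-≥1-∧ : ∀ {k} {c} → 1 ℕ.≤ k → nonzero? G k ∧ c ≡ c
  nonzero?-≥1-∧ (s≤s _) = refl

  module Extension (f : Fin n → ℤ) where

    kinkAt : Fin m → ℕ
    kinkAt e = len e ∸ r G f (e , true)

    slope : Fin m → ℤ
    slope e = δ G f (e , true)

    profile : Fin m → ℕ → ℤ
    profile e = kink (f (src e)) (slope e) (kinkAt e)

    extend : VH G → ℤ
    extend (vert u)  = f u
    extend (mid e i) = profile e (suc (toℕ i))

    r<len : ∀ e b → r G f (e , b) ℕ.< len e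
    r<len e b = n%ℕd<d (Δ G f (e , b)) (len e) {{len-pos e}}

    1≤kinkAt : ∀ e → 1 ℕ.≤ kinkAt e
    1≤kinkAt e = ℕP.m<n⇒0<n∸m (r<len e true)

    kinkAt≤len : ∀ e → kinkAt e ℕ.≤ len e
    kinkAt≤len e = ℕP.m∸n≤m (len e) (r G f (e , true))

    Δ-divmod : ∀ e b → Δ G f (e , b) ≡ + r G f (e , b) + δ G f (e , b) * + len e
    Δ-divmod e b = a≡a%ℕn+[a/ℕn]*n (Δ G f (e , b)) (len e) {{len-pos e}}

    profile-len : ∀ e → profile e (len e) ≡ f (tgt e)
    profile-len e = begin
      f (src e) + + len e * slope e + + (len e ∸ kinkAt e)
        ≡⟨ cong (λ n → f (src e) + + len e * slope e + + n) (ℕP.m∸[m∸n]≡n (ℕP.<⇒≤ (r<len e true))) ⟩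
      f (src e) + + len e * slope e + + r G f (e , true)
        ≡⟨ identity (f (src e)) (+ len e) _ _ ⟩
      f (src e) + (+ r G f (e , true) + slope e * + len e)
        ≡⟨ cong (λ z → f (src e) + z) (sym (Δ-divmod e true)) ⟩
      f (src e) + (f (tgt e) - f (src e))
        ≡⟨ telescope (f (src e)) (f (tgt e)) ⟩
      f (tgt e) ∎
      where
      open ≡-Reasoning
      identity : ∀ a L q R → a + L * q + R ≡ a + (R + q * L)
      identity = solve-∀
      telescope : ∀ a b → a + (b - a) ≡ b
      telescope = solve-∀

    extend-pos : ∀ e j → j ℕ.≤ len e → extend (pos G e j) ≡ profile e j
    extend-pos e zero    _ = sym (kink-0 (f (src e)) (slope e) (kinkAt e))
    extend-pos e (suc j) j+1≤len with suc j ℕ.<? len e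
    ... | yes _  = cong (profile e ∘ suc) (FinP.toℕ-fromℕ< _)
    ... | no j+1≮len = trans (sym (profile-len e)) (cong (profile e) (ℕP.≤-antisym (ℕP.≮⇒≥ j+1≮len) j+1≤len))

    Δ-reverse : ∀ e → Δ G f (e , false) ≡ - Δ G f (e , true)
    Δ-reverse e = i-j≡-[j-i] (f (src e)) (f (tgt e))

    reverse-divmod : ∀ e →
        (r G f (e , true) ≡ 0 × δ G f (e , false) ≡ - slope e × r G f (e , false) ≡ 0)
      ⊎ (1 ℕ.≤ r G f (e , true) × δ G f (e , false) ≡ - slope e - + 1 × r G f (e , false) ≡ kinkAt e)
    reverse-divmod e with r G f (e , true) ℕ.≟ 0
    ... | yes r≡0 = inj₁ (r≡0 , /ℕ-%ℕ-unique _ (len e) {{len-pos e}} (len≥1 e) (begin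
      Δ G f (e , false)                    ≡⟨ Δ-reverse e ⟩
      - Δ G f (e , true)                   ≡⟨ cong -_ (Δ-divmod e true) ⟩
      - (+ r G f (e , true) + slope e * + len e) ≡⟨ cong (λ ρ → - (+ ρ + slope e * + len e)) r≡0 ⟩
      - (+ 0 + slope e * + len e)                ≡⟨ identity (slope e) (+ len e) ⟩
      + 0 + - slope e * + len e                  ∎))
      where
      open ≡-Reasoning
      identity : ∀ q L → - (+ 0 + q * L) ≡ + 0 + - q * L
      identity = solve-∀
    ... | no r≢0 = inj₂ (ℕP.n≢0⇒n>0 r≢0 ,
                         /ℕ-%ℕ-unique _ (len e) {{len-pos e}}
                           (ℕP.∸-monoʳ-< (ℕP.n≢0⇒n>0 r≢0) (ℕP.<⇒≤ (r<len e true))) (begin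
      Δ G f (e , false)                              ≡⟨ Δ-reverse e ⟩
      - Δ G f (e , true)                             ≡⟨ cong -_ (Δ-divmod e true) ⟩
      - (+ r G f (e , true) + slope e * + len e)           ≡⟨ identity (+ r G f (e , true)) (slope e) (+ len e) ⟩
      (+ len e - + r G f (e , true)) + (- slope e - + 1) * + len e
        ≡⟨ cong (λ z → z + (- slope e - + 1) * + len e) (sym +[len∸r]) ⟩
      + kinkAt e + (- slope e - + 1) * + len e             ∎))
      where
      open ≡-Reasoning
      identity : ∀ R q L → - (R + q * L) ≡ (L - R) + (- q - + 1) * L
      identity = solve-∀
      +[len∸r] : + kinkAt e ≡ + len e - + r G f (e , true)
      +[len∸r] = trans (sym (ℤP.⊖-≥ (ℕP.<⇒≤ (r<len e true)))) (sym (ℤP.m-n≡m⊖n (len e) (r G f (e , true))))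

    reverse-slope : ∀ e → - (slope e + 𝟙 (kinkAt e ℕ.≤? len e ∸ 1)) ≡ δ G f (e , false)
    reverse-slope e with reverse-divmod e
    ... | inj₁ (r≡0 , δ′≡ , _) = begin
      - (slope e + 𝟙 (kinkAt e ℕ.≤? len e ∸ 1))  ≡⟨ cong (λ z → - (slope e + z))
                                                       (𝟙-no (kinkAt e ℕ.≤? len e ∸ 1) kinkAt≰) ⟩
      - (slope e + + 0)                          ≡⟨ cong -_ (ℤP.+-identityʳ _) ⟩
      - slope e                                  ≡⟨ sym δ′≡ ⟩
      δ G f (e , false)                          ∎
      where
      open ≡-Reasoning
      kinkAt≰ : kinkAt e ℕ.≰ len e ∸ 1
      kinkAt≰ = subst (ℕ._≰ len e ∸ 1) (cong (len e ∸_) (sym r≡0))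
                      (ℕP.<⇒≱ (ℕP.≤-reflexive (suc[len∸1]≡len e)))
    ... | inj₂ (1≤r , δ′≡ , _) = begin
      - (slope e + 𝟙 (kinkAt e ℕ.≤? len e ∸ 1))  ≡⟨ cong (λ z → - (slope e + z))
                                                       (𝟙-yes (kinkAt e ℕ.≤? len e ∸ 1) (ℕP.∸-monoʳ-≤ (len e) 1≤r)) ⟩
      - (slope e + + 1)                          ≡⟨ identity (slope e) ⟩
      - slope e - + 1                            ≡⟨ sym δ′≡ ⟩
      δ G f (e , false)                          ∎
      where
      open ≡-Reasoning
      identity : ∀ s → - (s + + 1) ≡ - s - + 1
      identity = solve-∀

    slope-src : ∀ e → extend (pos G e 1) - f (src e) ≡ slope e
    slope-src e = begin
      extend (pos G e 1) - f (src e)    ≡⟨ cong₂ _-_ (extend-pos e 1 (len≥1 e))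
                                                     (sym (kink-0 (f (src e)) (slope e) (kinkAt e))) ⟩
      profile e 1 - profile e 0         ≡⟨ kink-step (f (src e)) (slope e) (kinkAt e) 0 ⟩
      slope e + 𝟙 (kinkAt e ℕ.≤? 0)     ≡⟨ cong (λ z → slope e + z)
                                               (𝟙-no (kinkAt e ℕ.≤? 0) (ℕP.<⇒≱ (1≤kinkAt e))) ⟩
      slope e + + 0                     ≡⟨ ℤP.+-identityʳ _ ⟩
      slope e                           ∎
      where open ≡-Reasoning

    slope-tgt : ∀ e → extend (pos G e (len e ∸ 1)) - f (tgt e) ≡ δ G f (e , false)
    slope-tgt e = begin
      extend (pos G e (len e ∸ 1)) - f (tgt e)
        ≡⟨ cong₂ _-_ (extend-pos e _ (ℕP.m∸n≤m _ 1))
                     (sym (trans (cong (profile e) (suc[len∸1]≡len e)) (profile-len e))) ⟩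
      profile e (len e ∸ 1) - profile e (suc (len e ∸ 1))
        ≡⟨ i-j≡-[j-i] (profile e (len e ∸ 1)) _ ⟩
      - (profile e (suc (len e ∸ 1)) - profile e (len e ∸ 1))
        ≡⟨ cong -_ (kink-step (f (src e)) (slope e) (kinkAt e) (len e ∸ 1)) ⟩
      - (slope e + 𝟙 (kinkAt e ℕ.≤? len e ∸ 1))
        ≡⟨ reverse-slope e ⟩
      δ G f (e , false) ∎
      where open ≡-Reasoning

    r≡0⇒kink-not-interior : ∀ e → r G f (e , true) ≡ 0 → ∀ {e′} (i : Fin (len e′ ∸ 1)) →
                    ⌊ _≟V_ G (pos G e (kinkAt e)) (mid e′ i) ⌋ ≡ false
    r≡0⇒kink-not-interior e r≡0 i = ⌊⌋-no _ λ eq →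
      vert≢mid (trans (sym (pos-len e)) (trans (cong (pos G e ∘ (len e ∸_)) (sym r≡0)) eq))

    placesChip : OE G → VH G → Bool
    placesChip ε w = nonzero? G (r G f ε) ∧ ⌊ _≟V_ G (x G (rev G ε) (r G f ε)) w ⌋

    placesChip-kink : ∀ e b {e′} (i : Fin (len e′ ∸ 1)) →
                      placesChip (e , b) (mid e′ i) ≡ ⌊ _≟V_ G (pos G e (kinkAt e)) (mid e′ i) ⌋
    placesChip-kink e b i with reverse-divmod e
    placesChip-kink e true  i | inj₁ (r≡0 , _)          = trans (nonzero?-≡0-∧ r≡0) (sym (r≡0⇒kink-not-interior e r≡0 i))
    placesChip-kink e false i | inj₁ (r≡0 , _ , r′≡0)   = trans (nonzero?-≡0-∧ r′≡0) (sym (r≡0⇒kink-not-interior e r≡0 i))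
    placesChip-kink e true  i | inj₂ (1≤r , _)          = nonzero?-≥1-∧ 1≤r
    placesChip-kink e false i | inj₂ (_ , _ , r′≡kinkAt) =
      trans (nonzero?-≥1-∧ (subst (1 ℕ.≤_) (sym r′≡kinkAt) (1≤kinkAt e)))
            (cong (λ k → ⌊ _≟V_ G (pos G e k) (mid _ i) ⌋) r′≡kinkAt)

    div-ℓ-mid : ∀ e i → div-ℓ G f (mid e i) ≡ 𝟙 (suc (toℕ i) ℕ.≟ kinkAt e)
    div-ℓ-mid e i = trans (cong (λ b → if b then + 1 else + 0) chip-at-kink)
                          (𝟙-⇔ (pos≡mid⇔ e (kinkAt e) i) _ _)
      where
      either-orientation : ∀ e′ → placesChip (e′ , true) (mid e i) ∨ placesChip (e′ , false) (mid e i)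
                                  ≡ ⌊ _≟V_ G (pos G e′ (kinkAt e′)) (mid e i) ⌋
      either-orientation e′ =
        trans (cong₂ _∨_ (placesChip-kink e′ true i) (placesChip-kink e′ false i)) (BoolP.∨-idem _)
      chip-at-kink : anyOE G (λ ε → placesChip ε (mid e i)) ≡ ⌊ _≟V_ G (pos G e (kinkAt e)) (mid e i) ⌋
      chip-at-kink = trans
        (anyFin-single m _ e λ e′ e′≢e →
          trans (either-orientation e′) (⌊⌋-no _ (e′≢e ∘ pos≡mid⇒edge e′ (kinkAt e′) i)))
        (either-orientation e)

    divH-extend : ∀ w → divH G extend w ≡ div-ℓ G f w
    divH-extend (vert u) = trans (divH-vert extend u) (∑-cong m λ e → cong₂ _+_
      (cong (λ z → if ⌊ src e ≟F u ⌋ then z else + 0) (slope-src e))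
      (cong (λ z → if ⌊ tgt e ≟F u ⌋ then z else + 0) (slope-tgt e)))
    divH-extend (mid e i) = begin
      divH G extend (mid e i)               ≡⟨ divH-mid extend e i ⟩
      secondDiff (extend ∘ pos G e) (toℕ i) ≡⟨ secondDiff-cong (extend-pos e) (toℕ i)
                                                               (<∸1⇒suc< (FinP.toℕ<n i)) ⟩
      secondDiff (profile e) (toℕ i)        ≡⟨ secondDiff-kink (f (src e)) (slope e) (kinkAt e) (toℕ i) ⟩
      𝟙 (suc (toℕ i) ℕ.≟ kinkAt e)          ≡⟨ sym (div-ℓ-mid e i) ⟩
      div-ℓ G f (mid e i)                   ∎
      where open ≡-Reasoning

    profile-unique : ∀ e (a : ℕ → ℤ) {P} → 1 ℕ.≤ P → P ℕ.≤ len e →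
      a 0 ≡ f (src e) → a (len e) ≡ f (tgt e) →
      (∀ k → suc k ℕ.< len e → secondDiff a k ≡ 𝟙 (suc k ℕ.≟ P)) →
      ∀ j → j ℕ.≤ len e → a j ≡ profile e j
    profile-unique e a {P} 1≤P P≤len a₀≡ a-end≡ chip j j≤len = begin
      a j                                    ≡⟨ a≗kink j j≤len ⟩
      kink (a 0) s P j                       ≡⟨ cong₂ (λ s′ P′ → kink (a 0) s′ P′ j)
                                                        (proj₁ same-parameters) (proj₂ same-parameters) ⟩
      kink (a 0) (slope e) (kinkAt e) j      ≡⟨ cong (λ a₀ → kink a₀ (slope e) (kinkAt e) j) a₀≡ ⟩
      profile e j                            ∎
      where
      open ≡-Reasoning
      s : ℤ
      s = a 1 - a 0
      a≗kink : ∀ j → j ℕ.≤ len e → a j ≡ kink (a 0) s P j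
      a≗kink = secondDiff-unique (len e) a (kink (a 0) s P)
        (sym (kink-0 (a 0) s P))
        (sym (trans (kink-1 (a 0) s 1≤P) (telescope (a 0) (a 1))))
        (λ k k+1<len → trans (chip k k+1<len) (sym (secondDiff-kink (a 0) s P k)))
        where
        telescope : ∀ a₀ a₁ → a₀ + (a₁ - a₀) ≡ a₁
        telescope = solve-∀
      same-end : kink (f (src e)) s P (len e) ≡ profile e (len e)
      same-end = begin
        kink (f (src e)) s P (len e)  ≡⟨ cong (λ a₀ → kink a₀ s P (len e)) (sym a₀≡) ⟩
        kink (a 0) s P (len e)        ≡⟨ sym (a≗kink (len e) ℕP.≤-refl) ⟩
        a (len e)                     ≡⟨ a-end≡ ⟩
        f (tgt e)                     ≡⟨ sym (profile-len e) ⟩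
        profile e (len e)             ∎
      same-parameters : s ≡ slope e × P ≡ kinkAt e
      same-parameters = kink-unique (f (src e)) s (slope e) 1≤P P≤len (1≤kinkAt e) (kinkAt≤len e) same-end

    chips-of-div-ℓ : ∀ D → SupportInV G D →
                     ∀ e i → _⊕_ G D (div-ℓ G f) (mid e i) ≡ 𝟙 (suc (toℕ i) ℕ.≟ kinkAt e)
    chips-of-div-ℓ D supp e i =
      trans (cong (λ z → z + div-ℓ G f (mid e i)) (supp e i)) (trans (ℤP.+-identityˡ _) (div-ℓ-mid e i))

  open Extension

  atMostOneChip-along : ∀ D′ e P → (∀ i → D′ (mid e i) ≡ 𝟙 (suc (toℕ i) ℕ.≟ P)) →
                        AtMostOneChip (len e) (D′ ∘ pos G e)
  atMostOneChip-along D′ e P chip = chipAt⇒atMostOneChip P λ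
    { (suc k) _ k+1<len → trans (cong D′ (pos-interior e k k+1<len))
                                (trans (chip _) (cong (λ t → 𝟙 (suc t ℕ.≟ P)) (FinP.toℕ-fromℕ< _))) }

  admissible-from-chips : ∀ D′ (P : Fin m → ℕ) → (∀ e i → D′ (mid e i) ≡ 𝟙 (suc (toℕ i) ℕ.≟ P e)) →
                          Admissible G D′
  admissible-from-chips D′ P chips (e , true)  = atMostOneChip-along D′ e (P e) (chips e)
  admissible-from-chips D′ P chips (e , false) = atMostOneChip-reverse (atMostOneChip-along D′ e (P e) (chips e))

  module _ (D : Div G) {D′ : Div G} (supp : SupportInV G D) (F : VH G → ℤ)
           (D′≡D+divF : ∀ w → D′ w ≡ D w + divH G F w) where

    secondDiff-along-edge : ∀ e k → suc k ℕ.< len e → secondDiff (F ∘ pos G e) k ≡ D′ (pos G e (suc k))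
    secondDiff-along-edge e k k+1<len = sym (begin
      D′ (pos G e (suc k))                    ≡⟨ cong D′ (pos-interior e k k+1<len) ⟩
      D′ (mid e i)                            ≡⟨ D′≡D+divF (mid e i) ⟩
      D (mid e i) + divH G F (mid e i)        ≡⟨ cong₂ _+_ (supp e i) (divH-mid F e i) ⟩
      + 0 + secondDiff (F ∘ pos G e) (toℕ i)  ≡⟨ ℤP.+-identityˡ _ ⟩
      secondDiff (F ∘ pos G e) (toℕ i)        ≡⟨ cong (secondDiff (F ∘ pos G e)) (FinP.toℕ-fromℕ< _) ⟩
      secondDiff (F ∘ pos G e) k              ∎)
      where
      open ≡-Reasoning
      i : Fin (len e ∸ 1)
      i = fromℕ< (pred-< k+1<len)

    admissible⇒extends-restriction : Admissible G D′ → ∀ v → F v ≡ extend (F ∘ vert) v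
    admissible⇒extends-restriction adm (vert u)  = refl
    admissible⇒extends-restriction adm (mid e i) with atMostOneChip⇒chipAt (len≥1 e) (adm (e , true))
    ... | P , 1≤P , P≤len , chip =
      trans (cong F (sym (pos-mid e i)))
            (profile-unique (F ∘ vert) e (F ∘ pos G e) 1≤P P≤len refl (cong F (pos-len e))
              (λ k k+1<len → trans (secondDiff-along-edge e k k+1<len) (chip (suc k) (s≤s z≤n) k+1<len))
              (suc (toℕ i)) (ℕP.<⇒≤ (<∸1⇒suc< (FinP.toℕ<n i))))

theorem2p4 : (G : MetricGraph) → Loopless G → Connected G →
    (D : Div G) → SupportInV G D →
      ((f : Fin (MetricGraph.n G) → ℤ) →
          Admissible G (_⊕_ G D (div-ℓ G f)) × LinEquiv G D (_⊕_ G D (div-ℓ G f)))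
    × ((D′ : Div G) → Admissible G D′ → LinEquiv G D D′ →
          Σ (Fin (MetricGraph.n G) → ℤ) λ f → (w : VH G) → D′ w ≡ _⊕_ G D (div-ℓ G f) w)
theorem2p4 G _ _ D supp =
    (λ f → admissible-from-chips (_⊕_ G D (div-ℓ G f)) (kinkAt f) (chips-of-div-ℓ f D supp)
         , extend f , λ w → cong (λ z → D w + z) (sym (divH-extend f w)))
  , λ { D′ adm′ (F , D′≡D+divF) →
          F ∘ vert , λ w → trans (D′≡D+divF w) (cong (λ z → D w + z)
            (trans (divH-cong (admissible⇒extends-restriction D supp F D′≡D+divF adm′) w)
                   (divH-extend (F ∘ vert) w))) }
  where
  open Subdivision G
  open Extension
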